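{- For all integers $n\geq 1$ and $p\geq 0$, \[ B_{n,p}=(p+1)\sum_{k=1}^{n}\left\{ {n \atop k}\right\} \frac{(-1)^{n+k+1}\,k!}{(k+p)(k+p+1)}. \] In particular, for $p=0$, \[ B_{n}=\sum_{k=1}^{n}\left\{ {n \atop k}\right\} \frac{(-1)^{n+k+1}(k-1)!}{k+1}. \]
   Context: $\left\{ {n \atop k}\right\}$ denotes the Stirling number of the second kind. For each integer $p\geq 0$, the $p$-Bernoulli numbers $B_{n,p}$ ($n\geq 0$) are defined by $B_{0,p}=1$ and $B_{n+1,p}=pB_{n,p}-\frac{(p+1)^{2}}{p+2}B_{n,p+1}$ for $n,p\geq 0$; equivalently $\sum_{n\ge 0}B_{n,p}\frac{t^n}{n!}=(p+1)\int_{ -1}^{0}\frac{(1+y)^p}{1-y(e^t-1)}\,dy$. For $p=0$, $B_{n,0}=B_n$ are the classical Bernoulli numbers, $\sum_{n\ge0}B_nt^n/n!=t/(e^t-1)$ (so $B_1=-1/2$). -}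

module Defs where

open import Data.Nat as ℕ using (ℕ; zero; suc; _!)
open import Data.Integer as ℤ using (ℤ; +_)
open import Data.Rational using (ℚ; _+_; _*_; _-_; _/_; 0ℚ; 1ℚ)

stirling2 : ℕ → ℕ → ℕ
stirling2 zero    zero    = 1
stirling2 zero    (suc k) = 0
stirling2 (suc n) zero    = 0
stirling2 (suc n) (suc k) = suc k ℕ.* stirling2 n (suc k) ℕ.+ stirling2 n k

ℕ→ℚ : ℕ → ℚ
ℕ→ℚ m = (+ m) / 1

sign : ℕ → ℚ
sign zero    = 1ℚ
sign (suc m) = Data.Rational.- sign m

pB : ℕ → ℕ → ℚ
pB zero    p = 1ℚ
pB (suc n) p = ℕ→ℚ p * pB n p - ((+ ((suc p) ℕ.* (suc p))) / (suc (suc p))) * pB n (suc p)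

-- finite sum  Σ_{k=1}^{n} f k, where f receives k written as suc j (j = k - 1),
-- so that f can use k ≥ 1 definitionally (e.g. in nonzero denominators)
sum1 : ℕ → (ℕ → ℚ) → ℚ
sum1 zero    f = 0ℚ
sum1 (suc n) f = sum1 n f + f n

-- Write T(n,p) for the alternating Stirling sum on the right, so the claim is
-- B_{n,p} = (p+1) T(n,p).  Since B_{n,p} is determined by B_{0,p} = 1 and its
-- recurrence, it suffices to check the case n = 1 and that
-- T(n+1,p) = p T(n,p) - (p+1) T(n,p+1) for n ≥ 1.  Splitting S(n+1,k) as
-- k S(n,k) + S(n,k-1) and shifting k in the second part, this follows termwise
-- from the identity g(k+1,p) = (k+p) g(k,p) - (p+1) g(k,p+1) for the weights
-- g(k,p) = k!/((k+p)(k+p+1)).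
module Submission where

open import Defs
open import Data.Nat as ℕ using (ℕ; zero; suc; _!; _≥_; s≤s)
import Data.Nat.Properties as ℕ
open import Data.Integer as ℤ using (+_)
import Data.Integer.Properties as ℤ
import Data.Integer.Tactic.RingSolver as ℤ-Solver
open import Data.Rational using (ℚ; _+_; _*_; _-_; -_; _/_; 0ℚ; 1ℚ; toℚᵘ; fromℚᵘ)
open import Data.Rational.Properties
  using (_≟_; +-0-group; +-0-commutativeMonoid; +-*-commutativeRing;
         +-assoc; +-identityˡ; +-identityʳ; *-distribʳ-+; *-zeroˡ; *-identityˡ; *-identityʳ;
         toℚᵘ-injective; toℚᵘ-fromℚᵘ; toℚᵘ-homo-+; toℚᵘ-homo-*; fromℚᵘ-cong)
import Data.Rational.Unnormalised as ℚᵘ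
import Data.Rational.Unnormalised.Properties as ℚᵘ
open import Algebra.Bundles using (CommutativeMonoid)
open import Algebra.Properties.Group +-0-group using (⁻¹-involutive)
open import Algebra.Properties.CommutativeSemigroup
  (CommutativeMonoid.commutativeSemigroup +-0-commutativeMonoid) using (interchange)
open import Data.Maybe using (Maybe; just; nothing)
open import Data.Product using (_×_; _,_)
open import Level using (0ℓ)
open import Relation.Nullary using (yes; no)
open import Relation.Binary.PropositionalEquality
  using (_≡_; refl; sym; trans; cong; cong₂; module ≡-Reasoning)
import Tactic.RingSolver.Core.AlmostCommutativeRing as ACR
open import Tactic.RingSolver using (solve-∀)

ℚ-ring : ACR.AlmostCommutativeRing 0ℓ 0ℓ
ℚ-ring = ACR.fromCommutativeRing +-*-commutativeRing is-zero
  where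
  is-zero : (x : ℚ) → Maybe (0ℚ ≡ x)
  is-zero x with 0ℚ ≟ x
  ... | yes 0≡x = just 0≡x
  ... | no _    = nothing

fromℚᵘ-homo-+ : ∀ p q → fromℚᵘ (p ℚᵘ.+ q) ≡ fromℚᵘ p + fromℚᵘ q
fromℚᵘ-homo-+ p q = toℚᵘ-injective (begin
  toℚᵘ (fromℚᵘ (p ℚᵘ.+ q))              ≈⟨ toℚᵘ-fromℚᵘ (p ℚᵘ.+ q) ⟩
  p ℚᵘ.+ q                              ≈⟨ ℚᵘ.+-cong (toℚᵘ-fromℚᵘ p) (toℚᵘ-fromℚᵘ q) ⟨
  toℚᵘ (fromℚᵘ p) ℚᵘ.+ toℚᵘ (fromℚᵘ q)  ≈⟨ toℚᵘ-homo-+ (fromℚᵘ p) (fromℚᵘ q) ⟨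
  toℚᵘ (fromℚᵘ p + fromℚᵘ q)            ∎)
  where open ℚᵘ.≃-Reasoning

fromℚᵘ-homo-* : ∀ p q → fromℚᵘ (p ℚᵘ.* q) ≡ fromℚᵘ p * fromℚᵘ q
fromℚᵘ-homo-* p q = toℚᵘ-injective (begin
  toℚᵘ (fromℚᵘ (p ℚᵘ.* q))              ≈⟨ toℚᵘ-fromℚᵘ (p ℚᵘ.* q) ⟩
  p ℚᵘ.* q                              ≈⟨ ℚᵘ.*-cong (toℚᵘ-fromℚᵘ p) (toℚᵘ-fromℚᵘ q) ⟨
  toℚᵘ (fromℚᵘ p) ℚᵘ.* toℚᵘ (fromℚᵘ q)  ≈⟨ toℚᵘ-homo-* (fromℚᵘ p) (fromℚᵘ q) ⟨
  toℚᵘ (fromℚᵘ p * fromℚᵘ q)            ∎)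
  where open ℚᵘ.≃-Reasoning

-- Both ℕ→ℚ m and + m / suc d are definitionally fromℚᵘ of an unnormalised
-- fraction, so the identities below reduce to cross-multiplications in ℤ.

ℕ→ℚ-homo-+ : ∀ m n → ℕ→ℚ (m ℕ.+ n) ≡ ℕ→ℚ m + ℕ→ℚ n
ℕ→ℚ-homo-+ m n = trans
  (fromℚᵘ-cong {ℚᵘ.mkℚᵘ (+ (m ℕ.+ n)) 0} {ℚᵘ.mkℚᵘ (+ m) 0 ℚᵘ.+ ℚᵘ.mkℚᵘ (+ n) 0}
    (ℚᵘ.*≡* (trans (cong (ℤ._* + 1) (ℤ.pos-+ m n)) (cross (+ m) (+ n)))))
  (fromℚᵘ-homo-+ (ℚᵘ.mkℚᵘ (+ m) 0) (ℚᵘ.mkℚᵘ (+ n) 0))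
  where
  cross : ∀ a b → (a ℤ.+ b) ℤ.* + 1 ≡ (a ℤ.* + 1 ℤ.+ b ℤ.* + 1) ℤ.* + 1
  cross = ℤ-Solver.solve-∀

ℕ→ℚ-homo-* : ∀ m n → ℕ→ℚ (m ℕ.* n) ≡ ℕ→ℚ m * ℕ→ℚ n
ℕ→ℚ-homo-* m n = trans
  (fromℚᵘ-cong {ℚᵘ.mkℚᵘ (+ (m ℕ.* n)) 0} {ℚᵘ.mkℚᵘ (+ m) 0 ℚᵘ.* ℚᵘ.mkℚᵘ (+ n) 0}
    (ℚᵘ.*≡* (cong (ℤ._* + 1) (ℤ.pos-* m n))))
  (fromℚᵘ-homo-* (ℚᵘ.mkℚᵘ (+ m) 0) (ℚᵘ.mkℚᵘ (+ n) 0))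

ℕ→ℚ-suc : ∀ m → ℕ→ℚ (suc m) ≡ 1ℚ + ℕ→ℚ m
ℕ→ℚ-suc = ℕ→ℚ-homo-+ 1

1/ℕ : (n : ℕ) → .{{ℕ.NonZero n}} → ℚ
1/ℕ n = + 1 / n

1/ℕ-cong : ∀ {m n} .{{_ : ℕ.NonZero m}} .{{_ : ℕ.NonZero n}} → m ≡ n → 1/ℕ m ≡ 1/ℕ n
1/ℕ-cong refl = refl

1/ℕ-homo-* : ∀ m n → 1/ℕ (suc m ℕ.* suc n) ≡ 1/ℕ (suc m) * 1/ℕ (suc n)
1/ℕ-homo-* m n = trans
  (fromℚᵘ-cong {ℚᵘ.mkℚᵘ (+ 1) (n ℕ.+ m ℕ.* suc n)} {ℚᵘ.mkℚᵘ (+ 1) m ℚᵘ.* ℚᵘ.mkℚᵘ (+ 1) n}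
    (ℚᵘ.*≡* refl))
  (fromℚᵘ-homo-* (ℚᵘ.mkℚᵘ (+ 1) m) (ℚᵘ.mkℚᵘ (+ 1) n))

/-≡-*1/ℕ : ∀ m d → + m / suc d ≡ ℕ→ℚ m * 1/ℕ (suc d)
/-≡-*1/ℕ m d = trans
  (fromℚᵘ-cong {ℚᵘ.mkℚᵘ (+ m) d} {ℚᵘ.mkℚᵘ (+ m) 0 ℚᵘ.* ℚᵘ.mkℚᵘ (+ 1) d}
    (ℚᵘ.*≡* (trans (cong (+ m ℤ.*_) (ℤ.pos-* 1 (suc d))) (cross (+ m) (+ suc d)))))
  (fromℚᵘ-homo-* (ℚᵘ.mkℚᵘ (+ m) 0) (ℚᵘ.mkℚᵘ (+ 1) d))
  where
  cross : ∀ a b → a ℤ.* (+ 1 ℤ.* b) ≡ (a ℤ.* + 1) ℤ.* b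
  cross = ℤ-Solver.solve-∀

*-inverseʳ-1/ℕ : ∀ d → ℕ→ℚ (suc d) * 1/ℕ (suc d) ≡ 1ℚ
*-inverseʳ-1/ℕ d = trans
  (sym (fromℚᵘ-homo-* (ℚᵘ.mkℚᵘ (+ suc d) 0) (ℚᵘ.mkℚᵘ (+ 1) d)))
  (fromℚᵘ-cong {ℚᵘ.mkℚᵘ (+ suc d) 0 ℚᵘ.* ℚᵘ.mkℚᵘ (+ 1) d} {ℚᵘ.mkℚᵘ (+ 1) 0}
    (ℚᵘ.*≡* (trans (cross (+ suc d)) (cong (+ 1 ℤ.*_) (sym (ℤ.pos-* 1 (suc d)))))))
  where
  cross : ∀ a → (a ℤ.* + 1) ℤ.* + 1 ≡ + 1 ℤ.* (+ 1 ℤ.* a)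
  cross = ℤ-Solver.solve-∀

/-*-cancel : ∀ m d → (+ m / suc d) * ℕ→ℚ (suc d) ≡ ℕ→ℚ m
/-*-cancel m d = begin
  (+ m / suc d) * ℕ→ℚ (suc d)        ≡⟨ cong (_* ℕ→ℚ (suc d)) (/-≡-*1/ℕ m d) ⟩
  ℕ→ℚ m * 1/ℕ (suc d) * ℕ→ℚ (suc d)  ≡⟨ swap (ℕ→ℚ m) (1/ℕ (suc d)) (ℕ→ℚ (suc d)) ⟩
  ℕ→ℚ m * (ℕ→ℚ (suc d) * 1/ℕ (suc d)) ≡⟨ cong (ℕ→ℚ m *_) (*-inverseʳ-1/ℕ d) ⟩
  ℕ→ℚ m * 1ℚ                          ≡⟨ *-identityʳ (ℕ→ℚ m) ⟩
  ℕ→ℚ m                               ∎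
  where
  open ≡-Reasoning
  swap : ∀ a b c → a * b * c ≡ a * (c * b)
  swap = solve-∀ ℚ-ring

sign-suc-suc : ∀ m → sign (suc (suc m)) ≡ sign m
sign-suc-suc m = ⁻¹-involutive (sign m)

stirling2-vanishes : ∀ {n k} → n ℕ.< k → stirling2 n k ≡ 0
stirling2-vanishes {zero}  {suc k} _         = refl
stirling2-vanishes {suc n} {suc k} (s≤s n<k)
  rewrite stirling2-vanishes (ℕ.m<n⇒m<1+n n<k) | stirling2-vanishes n<k
  = trans (ℕ.+-identityʳ (suc k ℕ.* 0)) (ℕ.*-zeroʳ (suc k))

sum1-cong : ∀ n {f g} → (∀ j → f j ≡ g j) → sum1 n f ≡ sum1 n g
sum1-cong zero    f≗g = refl
sum1-cong (suc n) f≗g = cong₂ _+_ (sum1-cong n f≗g) (f≗g n)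

sum1-+ : ∀ n f g → sum1 n (λ j → f j + g j) ≡ sum1 n f + sum1 n g
sum1-+ zero    f g = refl
sum1-+ (suc n) f g = trans (cong (_+ (f n + g n)) (sum1-+ n f g))
                           (interchange (sum1 n f) (sum1 n g) (f n) (g n))

sum1-shift : ∀ n f → sum1 (suc n) f ≡ f 0 + sum1 n (λ j → f (suc j))
sum1-shift zero    f = trans (+-identityˡ (f 0)) (sym (+-identityʳ (f 0)))
sum1-shift (suc n) f = trans (cong (_+ f (suc n)) (sum1-shift n f))
                             (+-assoc (f 0) (sum1 n (λ j → f (suc j))) (f (suc n)))

sum1-+-reindex : ∀ n f g → f n ≡ 0ℚ → g 0 ≡ 0ℚ →
                 sum1 (suc n) (λ j → f j + g j) ≡ sum1 n (λ j → f j + g (suc j))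
sum1-+-reindex n f g fn≡0 g0≡0 = begin
  sum1 (suc n) (λ j → f j + g j)                 ≡⟨ sum1-+ (suc n) f g ⟩
  (sum1 n f + f n) + sum1 (suc n) g              ≡⟨ cong₂ (λ a b → (sum1 n f + a) + b) fn≡0 (sum1-shift n g) ⟩
  (sum1 n f + 0ℚ) + (g 0 + sum1 n (λ j → g (suc j)))
    ≡⟨ cong (λ a → (sum1 n f + 0ℚ) + (a + sum1 n (λ j → g (suc j)))) g0≡0 ⟩
  (sum1 n f + 0ℚ) + (0ℚ + sum1 n (λ j → g (suc j)))
    ≡⟨ cong₂ _+_ (+-identityʳ (sum1 n f)) (+-identityˡ (sum1 n (λ j → g (suc j)))) ⟩
  sum1 n f + sum1 n (λ j → g (suc j))            ≡⟨ sum1-+ n f (λ j → g (suc j)) ⟨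
  sum1 n (λ j → f j + g (suc j))                 ∎
  where open ≡-Reasoning

sum1-linear : ∀ n a b f g → sum1 n (λ j → a * f j - b * g j) ≡ a * sum1 n f - b * sum1 n g
sum1-linear zero    a b f g = empty a b
  where
  empty : ∀ a b → 0ℚ ≡ a * 0ℚ - b * 0ℚ
  empty = solve-∀ ℚ-ring
sum1-linear (suc n) a b f g = trans (cong (_+ (a * f n - b * g n)) (sum1-linear n a b f g))
                                    (step a b (sum1 n f) (sum1 n g) (f n) (g n))
  where
  step : ∀ a b x y u v → (a * x - b * y) + (a * u - b * v) ≡ a * (x + u) - b * (y + v)
  step = solve-∀ ℚ-ring

-- weight j p is g(k,p) = k!/((k+p)(k+p+1)) at k = suc j, and stirlingSum n p is T(n,p).
weight : ℕ → ℕ → ℚ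
weight j p = + (suc j !) / ((suc j ℕ.+ p) ℕ.* (suc j ℕ.+ p ℕ.+ 1))

stirlingTerm : ℕ → ℕ → ℕ → ℚ
stirlingTerm n p j = ℕ→ℚ (stirling2 n (suc j)) * (sign (n ℕ.+ suc j ℕ.+ 1) * weight j p)

stirlingSum : ℕ → ℕ → ℚ
stirlingSum n p = sum1 n (stirlingTerm n p)

weight-as-product : ∀ j p {a} → j ℕ.+ p ≡ a →
                    weight j p ≡ ℕ→ℚ (suc j !) * (1/ℕ (suc a) * 1/ℕ (suc (suc a)))
weight-as-product j p refl = begin
  weight j p
    ≡⟨ /-≡-*1/ℕ (suc j !) _ ⟩
  ℕ→ℚ (suc j !) * 1/ℕ (suc (j ℕ.+ p) ℕ.* suc (j ℕ.+ p ℕ.+ 1))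
    ≡⟨ cong (ℕ→ℚ (suc j !) *_) (1/ℕ-homo-* (j ℕ.+ p) (j ℕ.+ p ℕ.+ 1)) ⟩
  ℕ→ℚ (suc j !) * (1/ℕ (suc (j ℕ.+ p)) * 1/ℕ (suc (j ℕ.+ p ℕ.+ 1)))
    ≡⟨ cong (λ y → ℕ→ℚ (suc j !) * (1/ℕ (suc (j ℕ.+ p)) * y))
            (1/ℕ-cong (cong suc (ℕ.+-comm (j ℕ.+ p) 1))) ⟩
  ℕ→ℚ (suc j !) * (1/ℕ (suc (j ℕ.+ p)) * 1/ℕ (suc (suc (j ℕ.+ p)))) ∎
  where open ≡-Reasoning

weight-suc : ∀ j p → weight (suc j) p ≡ (ℕ→ℚ (suc j) + ℕ→ℚ p) * weight j p - ℕ→ℚ (suc p) * weight j (suc p)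
weight-suc j p = begin
  weight (suc j) p
    ≡⟨ weight-as-product (suc j) p refl ⟩
  ℕ→ℚ (suc (suc j) ℕ.* suc j !) * (y * z)
    ≡⟨ cong (_* (y * z)) (trans (ℕ→ℚ-homo-* (suc (suc j)) (suc j !)) (cong (_* F) (ℕ→ℚ-suc (suc j)))) ⟩
  (1ℚ + K) * F * (y * z)
    ≡⟨ recurrence K P F x y z Kx Kz ⟩
  (K + P) * (F * (x * y)) - (1ℚ + P) * (F * (y * z))
    ≡⟨ cong₂ (λ u v → u - v)
         (cong ((K + P) *_) (weight-as-product j p refl))
         (cong₂ _*_ (ℕ→ℚ-suc p) (weight-as-product j (suc p) (ℕ.+-suc j p))) ⟨
  (ℕ→ℚ (suc j) + ℕ→ℚ p) * weight j p - ℕ→ℚ (suc p) * weight j (suc p) ∎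
  where
  open ≡-Reasoning
  a = j ℕ.+ p
  K = ℕ→ℚ (suc j)
  P = ℕ→ℚ p
  F = ℕ→ℚ (suc j !)
  x = 1/ℕ (suc a)
  y = 1/ℕ (suc (suc a))
  z = 1/ℕ (suc (suc (suc a)))
  Kx : (K + P) * x ≡ 1ℚ
  Kx = trans (cong (_* x) (sym (ℕ→ℚ-homo-+ (suc j) p))) (*-inverseʳ-1/ℕ a)
  Kz : (1ℚ + (1ℚ + (K + P))) * z ≡ 1ℚ
  Kz = trans (cong (λ t → (1ℚ + (1ℚ + t)) * z) (sym (ℕ→ℚ-homo-+ (suc j) p)))
             (trans (cong (_* z) (sym (trans (ℕ→ℚ-suc (suc (suc a))) (cong (λ t → 1ℚ + t) (ℕ→ℚ-suc (suc a))))))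
                    (*-inverseʳ-1/ℕ (suc (suc a))))
  recurrence : ∀ K P F x y z → (K + P) * x ≡ 1ℚ → (1ℚ + (1ℚ + (K + P))) * z ≡ 1ℚ →
               (1ℚ + K) * F * (y * z) ≡ (K + P) * (F * (x * y)) - (1ℚ + P) * (F * (y * z))
  recurrence K P F x y z Kx Kz = begin
    (1ℚ + K) * F * (y * z)
      ≡⟨ expand K P F x y z ⟩
    (K + P) * (F * (x * y)) - (1ℚ + P) * (F * (y * z)) + F * y * ((1ℚ + (1ℚ + (K + P))) * z - (K + P) * x)
      ≡⟨ cong₂ (λ u v → (K + P) * (F * (x * y)) - (1ℚ + P) * (F * (y * z)) + F * y * (u - v)) Kz Kx ⟩
    (K + P) * (F * (x * y)) - (1ℚ + P) * (F * (y * z)) + F * y * (1ℚ - 1ℚ)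
      ≡⟨ collapse ((K + P) * (F * (x * y)) - (1ℚ + P) * (F * (y * z))) (F * y) ⟩
    (K + P) * (F * (x * y)) - (1ℚ + P) * (F * (y * z)) ∎
    where
    expand : ∀ K P F x y z → (1ℚ + K) * F * (y * z) ≡
      (K + P) * (F * (x * y)) - (1ℚ + P) * (F * (y * z)) + F * y * ((1ℚ + (1ℚ + (K + P))) * z - (K + P) * x)
    expand = solve-∀ ℚ-ring
    collapse : ∀ r c → r + c * (1ℚ - 1ℚ) ≡ r
    collapse = solve-∀ ℚ-ring

stirlingSum-suc : ∀ m p → stirlingSum (suc (suc m)) p ≡
                  ℕ→ℚ p * stirlingSum (suc m) p - ℕ→ℚ (suc p) * stirlingSum (suc m) (suc p)
stirlingSum-suc m p = begin
  stirlingSum (suc n) p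
    ≡⟨ sum1-cong (suc n) split ⟩
  sum1 (suc n) (λ j → A j + B j)
    ≡⟨ sum1-+-reindex n A B An≡0 (*-zeroˡ (c 0)) ⟩
  sum1 n (λ j → A j + B (suc j))
    ≡⟨ sum1-cong n combine ⟩
  sum1 n (λ j → ℕ→ℚ p * stirlingTerm n p j - ℕ→ℚ (suc p) * stirlingTerm n (suc p) j)
    ≡⟨ sum1-linear n (ℕ→ℚ p) (ℕ→ℚ (suc p)) (stirlingTerm n p) (stirlingTerm n (suc p)) ⟩
  ℕ→ℚ p * stirlingSum n p - ℕ→ℚ (suc p) * stirlingSum n (suc p) ∎
  where
  open ≡-Reasoning
  n = suc m
  c : ℕ → ℚ
  c j = sign (suc n ℕ.+ suc j ℕ.+ 1) * weight j p
  A B : ℕ → ℚ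
  A j = ℕ→ℚ (suc j ℕ.* stirling2 n (suc j)) * c j
  B j = ℕ→ℚ (stirling2 n j) * c j
  split : ∀ j → stirlingTerm (suc n) p j ≡ A j + B j
  split j = trans (cong (_* c j) (ℕ→ℚ-homo-+ (suc j ℕ.* stirling2 n (suc j)) (stirling2 n j)))
                  (*-distribʳ-+ (c j) (ℕ→ℚ (suc j ℕ.* stirling2 n (suc j))) (ℕ→ℚ (stirling2 n j)))
  An≡0 : A n ≡ 0ℚ
  An≡0 = trans (cong (λ t → ℕ→ℚ t * c n)
                     (trans (cong (suc n ℕ.*_) (stirling2-vanishes (ℕ.n<1+n n))) (ℕ.*-zeroʳ (suc n))))
               (*-zeroˡ (c n))
  combine : ∀ j → A j + B (suc j) ≡ ℕ→ℚ p * stirlingTerm n p j - ℕ→ℚ (suc p) * stirlingTerm n (suc p) j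
  combine j = begin
    A j + B (suc j)
      ≡⟨ cong₂ (λ u v → u * (- s * weight j p) + S * v)
               (ℕ→ℚ-homo-* (suc j) (stirling2 n (suc j)))
               (cong₂ _*_ sign-shift (weight-suc j p)) ⟩
    (K * S) * (- s * W₀) + S * (s * ((K + P) * W₀ - P₁ * W₁))
      ≡⟨ collect K S s W₀ W₁ P P₁ ⟩
    P * (S * (s * W₀)) - P₁ * (S * (s * W₁)) ∎
    where
    K = ℕ→ℚ (suc j)
    S = ℕ→ℚ (stirling2 n (suc j))
    P = ℕ→ℚ p
    P₁ = ℕ→ℚ (suc p)
    s = sign (n ℕ.+ suc j ℕ.+ 1)
    W₀ = weight j p
    W₁ = weight j (suc p)
    sign-shift : sign (suc n ℕ.+ suc (suc j) ℕ.+ 1) ≡ s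
    sign-shift = trans (cong (λ t → sign (suc (t ℕ.+ 1))) (ℕ.+-suc n (suc j))) (sign-suc-suc (n ℕ.+ suc j ℕ.+ 1))
    collect : ∀ K S s W₀ W₁ P P₁ →
              (K * S) * (- s * W₀) + S * (s * ((K + P) * W₀ - P₁ * W₁)) ≡ P * (S * (s * W₀)) - P₁ * (S * (s * W₁))
    collect = solve-∀ ℚ-ring

-- stirlingSum 1 p unfolds to 0ℚ + 1ℚ * (sign 3 * weight 0 p), and sign 3 is - 1ℚ.
pB-one : ∀ p → pB 1 p ≡ ℕ→ℚ (suc p) * stirlingSum 1 p
pB-one p = begin
  P * 1ℚ - (+ (suc p ℕ.* suc p) / suc (suc p)) * 1ℚ
    ≡⟨ cong (λ c → P * 1ℚ - c * 1ℚ)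
            (trans (/-≡-*1/ℕ (suc p ℕ.* suc p) (suc p))
                   (cong (_* y) (trans (ℕ→ℚ-homo-* (suc p) (suc p)) (cong₂ _*_ (ℕ→ℚ-suc p) (ℕ→ℚ-suc p))))) ⟩
  P * 1ℚ - ((1ℚ + P) * (1ℚ + P) * y) * 1ℚ
    ≡⟨ base P x y Px Py ⟩
  (1ℚ + P) * (0ℚ + 1ℚ * (- 1ℚ * (1ℚ * (x * y))))
    ≡⟨ cong₂ (λ u w → u * (0ℚ + 1ℚ * (- 1ℚ * w))) (ℕ→ℚ-suc p) (weight-as-product 0 p refl) ⟨
  ℕ→ℚ (suc p) * stirlingSum 1 p ∎
  where
  open ≡-Reasoning
  P = ℕ→ℚ p
  x = 1/ℕ (suc p)
  y = 1/ℕ (suc (suc p))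
  Px : (1ℚ + P) * x ≡ 1ℚ
  Px = trans (cong (_* x) (sym (ℕ→ℚ-suc p))) (*-inverseʳ-1/ℕ p)
  Py : (1ℚ + (1ℚ + P)) * y ≡ 1ℚ
  Py = trans (cong (λ t → (1ℚ + t) * y) (sym (ℕ→ℚ-suc p)))
             (trans (cong (_* y) (sym (ℕ→ℚ-suc (suc p)))) (*-inverseʳ-1/ℕ (suc p)))
  base : ∀ P x y → (1ℚ + P) * x ≡ 1ℚ → (1ℚ + (1ℚ + P)) * y ≡ 1ℚ →
         P * 1ℚ - ((1ℚ + P) * (1ℚ + P) * y) * 1ℚ ≡ (1ℚ + P) * (0ℚ + 1ℚ * (- 1ℚ * (1ℚ * (x * y))))
  base P x y Px Py = begin
    P * 1ℚ - ((1ℚ + P) * (1ℚ + P) * y) * 1ℚ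
      ≡⟨ expand P x y ⟩
    R + P * (1ℚ - (1ℚ + (1ℚ + P)) * y) + y * ((1ℚ + P) * x - 1ℚ)
      ≡⟨ cong₂ (λ u v → R + P * (1ℚ - u) + y * (v - 1ℚ)) Py Px ⟩
    R + P * (1ℚ - 1ℚ) + y * (1ℚ - 1ℚ)
      ≡⟨ collapse R P y ⟩
    R ∎
    where
    R = (1ℚ + P) * (0ℚ + 1ℚ * (- 1ℚ * (1ℚ * (x * y))))
    expand : ∀ P x y → P * 1ℚ - ((1ℚ + P) * (1ℚ + P) * y) * 1ℚ ≡
      (1ℚ + P) * (0ℚ + 1ℚ * (- 1ℚ * (1ℚ * (x * y)))) + P * (1ℚ - (1ℚ + (1ℚ + P)) * y) + y * ((1ℚ + P) * x - 1ℚ)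
    expand = solve-∀ ℚ-ring
    collapse : ∀ r a b → r + a * (1ℚ - 1ℚ) + b * (1ℚ - 1ℚ) ≡ r
    collapse = solve-∀ ℚ-ring

pB≡stirlingSum : ∀ m p → pB (suc m) p ≡ ℕ→ℚ (suc p) * stirlingSum (suc m) p
pB≡stirlingSum zero    p = pB-one p
pB≡stirlingSum (suc m) p = begin
  P * pB (suc m) p - c * pB (suc m) (suc p)
    ≡⟨ cong₂ (λ u v → P * u - c * v) (pB≡stirlingSum m p) (pB≡stirlingSum m (suc p)) ⟩
  P * (P₁ * stirlingSum (suc m) p) - c * (P₂ * stirlingSum (suc m) (suc p))
    ≡⟨ rescale P P₁ P₂ c (stirlingSum (suc m) p) (stirlingSum (suc m) (suc p)) cP₂ ⟩
  P₁ * (P * stirlingSum (suc m) p - P₁ * stirlingSum (suc m) (suc p))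
    ≡⟨ cong (P₁ *_) (stirlingSum-suc m p) ⟨
  P₁ * stirlingSum (suc (suc m)) p ∎
  where
  open ≡-Reasoning
  P = ℕ→ℚ p
  P₁ = ℕ→ℚ (suc p)
  P₂ = ℕ→ℚ (suc (suc p))
  c = + (suc p ℕ.* suc p) / suc (suc p)
  cP₂ : c * P₂ ≡ P₁ * P₁
  cP₂ = trans (/-*-cancel (suc p ℕ.* suc p) (suc p)) (ℕ→ℚ-homo-* (suc p) (suc p))
  rescale : ∀ P P₁ P₂ c X Y → c * P₂ ≡ P₁ * P₁ → P * (P₁ * X) - c * (P₂ * Y) ≡ P₁ * (P * X - P₁ * Y)
  rescale P P₁ P₂ c X Y cP₂ = begin
    P * (P₁ * X) - c * (P₂ * Y)  ≡⟨ reassociate P P₁ P₂ c X Y ⟩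
    P * (P₁ * X) - (c * P₂) * Y  ≡⟨ cong (λ t → P * (P₁ * X) - t * Y) cP₂ ⟩
    P * (P₁ * X) - (P₁ * P₁) * Y ≡⟨ factor P P₁ X Y ⟩
    P₁ * (P * X - P₁ * Y)        ∎
    where
    reassociate : ∀ P P₁ P₂ c X Y → P * (P₁ * X) - c * (P₂ * Y) ≡ P * (P₁ * X) - (c * P₂) * Y
    reassociate = solve-∀ ℚ-ring
    factor : ∀ P P₁ X Y → P * (P₁ * X) - (P₁ * P₁) * Y ≡ P₁ * (P * X - P₁ * Y)
    factor = solve-∀ ℚ-ring

weight-zero : ∀ j → weight j 0 ≡ + (j !) / (suc j ℕ.+ 1)
weight-zero j = begin
  weight j 0
    ≡⟨ weight-as-product j 0 (ℕ.+-identityʳ j) ⟩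
  ℕ→ℚ (suc j ℕ.* j !) * (x * y)
    ≡⟨ cong (_* (x * y)) (ℕ→ℚ-homo-* (suc j) (j !)) ⟩
  (ℕ→ℚ (suc j) * ℕ→ℚ (j !)) * (x * y)
    ≡⟨ cancel (ℕ→ℚ (suc j)) (ℕ→ℚ (j !)) x y (*-inverseʳ-1/ℕ j) ⟩
  ℕ→ℚ (j !) * y
    ≡⟨ trans (/-≡-*1/ℕ (j !) (j ℕ.+ 1)) (cong (ℕ→ℚ (j !) *_) (1/ℕ-cong (cong suc (ℕ.+-comm j 1)))) ⟨
  + (j !) / (suc j ℕ.+ 1) ∎
  where
  open ≡-Reasoning
  x = 1/ℕ (suc j)
  y = 1/ℕ (suc (suc j))
  cancel : ∀ K F x y → K * x ≡ 1ℚ → (K * F) * (x * y) ≡ F * y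
  cancel K F x y Kx = begin
    (K * F) * (x * y)  ≡⟨ regroup K F x y ⟩
    F * y * (K * x)    ≡⟨ cong (F * y *_) Kx ⟩
    F * y * 1ℚ         ≡⟨ *-identityʳ (F * y) ⟩
    F * y              ∎
    where
    regroup : ∀ K F x y → (K * F) * (x * y) ≡ F * y * (K * x)
    regroup = solve-∀ ℚ-ring

stirlingSum-zero : ∀ n → stirlingSum n 0 ≡
  sum1 n (λ j → ℕ→ℚ (stirling2 n (suc j)) * (sign (n ℕ.+ suc j ℕ.+ 1) * (+ (j !) / (suc j ℕ.+ 1))))
stirlingSum-zero n = sum1-cong n (λ j →
  cong (λ w → ℕ→ℚ (stirling2 n (suc j)) * (sign (n ℕ.+ suc j ℕ.+ 1) * w)) (weight-zero j))

theorem2 :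
    ((n p : ℕ) → n ≥ 1 →
      pB n p ≡ ℕ→ℚ (suc p) * sum1 n (λ j →
        ℕ→ℚ (stirling2 n (suc j)) * (sign (n ℕ.+ suc j ℕ.+ 1) * ((+ ((suc j) !)) / ((suc j ℕ.+ p) ℕ.* (suc j ℕ.+ p ℕ.+ 1))))))
    × ((n : ℕ) → n ≥ 1 →
      pB n 0 ≡ sum1 n (λ j →
        ℕ→ℚ (stirling2 n (suc j)) * (sign (n ℕ.+ suc j ℕ.+ 1) * ((+ (j !)) / (suc j ℕ.+ 1)))))
theorem2 = general , bernoulli
  where
  general : ∀ n p → n ≥ 1 → pB n p ≡ ℕ→ℚ (suc p) * stirlingSum n p
  general (suc m) p _ = pB≡stirlingSum m p
  bernoulli : ∀ n → n ≥ 1 → pB n 0 ≡ sum1 n (λ j →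
    ℕ→ℚ (stirling2 n (suc j)) * (sign (n ℕ.+ suc j ℕ.+ 1) * (+ (j !) / (suc j ℕ.+ 1))))
  bernoulli (suc m) _ = trans (pB≡stirlingSum m 0)
                              (trans (*-identityˡ (stirlingSum (suc m) 0)) (stirlingSum-zero (suc m)))
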